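{- Let $s\ge 2$ and let $f_1(x),\ldots,f_s(x)\in\mathbb{Z}[x]$ be monic coprime polynomials. Let $d^\ast$ be the gcd of all the integers $f_j(n)$, $j=1,\ldots,s$, $n\in\mathbb{Z}$ (equivalently, the gcd of all $d_n=\gcd(f_1(n),\ldots,f_s(n))$, $n\in\mathbb{Z}$). Then $d^\ast$ divides each of the integers $(\deg f_1)!,\ldots,(\deg f_s)!$.
   Context: Polynomials are coprime if their gcd in $\mathbb{Q}[x]$ is $1$ (equivalently, no common complex root). -}

module Defs where

open import Data.Nat using (ℕ; zero; suc; _∸_)
open import Data.Integer as ℤ using (ℤ; +_)
open import Data.Rational as ℚ using (ℚ; 0ℚ; _/_)
open import Data.List using (List; []; _∷_; _++_; [_]; map; length)
open import Data.Product using (∃)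
open import Data.Fin using (Fin)
open import Relation.Binary.PropositionalEquality using (_≡_)

-- Polynomials are coefficient lists, constant coefficient first:
-- a₀ ∷ a₁ ∷ … ∷ aₖ ∷ []  represents  a₀ + a₁ x + … + aₖ xᵏ.

ℤPoly : Set
ℤPoly = List ℤ

Monic : ℤPoly → Set
Monic p = ∃ λ (cs : List ℤ) → p ≡ cs ++ [ + 1 ]

-- degree (correct for polynomials whose last coefficient is nonzero,
-- in particular for monic ones)
deg : ℤPoly → ℕ
deg p = length p ∸ 1

evalℤ : ℤPoly → ℤ → ℤ
evalℤ []       n = + 0
evalℤ (a ∷ p)  n = a ℤ.+ n ℤ.* evalℤ p n

ℚPoly : Set
ℚPoly = List ℚ

coeff : ℚPoly → ℕ → ℚ
coeff []      _       = 0ℚ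
coeff (a ∷ p) zero    = a
coeff (a ∷ p) (suc i) = coeff p i

-- equality of polynomials: all coefficients agree (trailing zeros ignored)
_≈ₚ_ : ℚPoly → ℚPoly → Set
p ≈ₚ q = ∀ i → coeff p i ≡ coeff q i

addₚ : ℚPoly → ℚPoly → ℚPoly
addₚ []      q       = q
addₚ p       []      = p
addₚ (a ∷ p) (b ∷ q) = (a ℚ.+ b) ∷ addₚ p q

scaleₚ : ℚ → ℚPoly → ℚPoly
scaleₚ c = map (c ℚ.*_)

mulₚ : ℚPoly → ℚPoly → ℚPoly
mulₚ []      q = []
mulₚ (a ∷ p) q = addₚ (scaleₚ a q) (0ℚ ∷ mulₚ p q)

_∣ₚ_ : ℚPoly → ℚPoly → Set
h ∣ₚ f = ∃ λ (q : ℚPoly) → mulₚ h q ≈ₚ f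

IsConstant : ℚPoly → Set
IsConstant h = ∀ i → coeff h (suc i) ≡ 0ℚ

toℚPoly : ℤPoly → ℚPoly
toℚPoly = map (λ z → z / 1)

-- f₁,…,fₛ are coprime: their gcd in ℚ[x] is 1, i.e. every common divisor
-- in ℚ[x] is a unit (a constant; the zero polynomial cannot divide a
-- monic polynomial, so "constant" = "nonzero constant" = unit here).
Coprime : {s : ℕ} → (Fin s → ℤPoly) → Set
Coprime {s} f = ∀ (h : ℚPoly) → (∀ j → h ∣ₚ toℚPoly (f j)) → IsConstant h

-- Only one polynomial is needed: for a single polynomial f of degree ≤ k
-- whose coefficient of xᵏ is c, every integer dividing all values f(n)
-- divides c · k!. The proof is by
-- finite differences Δg(n) = g(n+1) − g(n):
--   * a common divisor of all values of g divides all values of Δg;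
--   * Δ lowers the degree by one and multiplies the top coefficient by
--     the degree, so Δᵏ f is the constant c · k!.
module Submission where

open import Defs
open import Data.Nat using (ℕ; _≤_; _!)
open import Data.Nat.Divisibility using (_∣_)
open import Data.Integer using (ℤ; ∣_∣)
open import Data.Fin using (Fin)

open import Data.Nat as ℕ using (zero; suc)
import Data.Nat.Properties as ℕP
open import Data.Integer using (+_; 0ℤ; 1ℤ; _+_; _*_; _-_)
import Data.Integer.Properties as ℤP
import Data.Integer.Divisibility.Signed as ℤ∣
open import Data.Integer.Tactic.RingSolver using (solve-∀)
open import Data.List using ([]; _∷_; _++_; [_]; length)
import Data.List.Properties as ListP
open import Data.Product using (_,_)
open import Function using (_∘_)
open import Relation.Binary.PropositionalEquality
  using (_≡_; refl; sym; trans; cong; cong₂; subst; module ≡-Reasoning)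

-- PolyFun k c g: g is (pointwise) a polynomial function of degree ≤ k
-- whose coefficient of nᵏ is c, witnessed in Horner form
-- g(n) = a₀ + n (a₁ + n (… + n c)).
data PolyFun : ℕ → ℤ → (ℤ → ℤ) → Set where
  constant : ∀ {c g} → (∀ n → g n ≡ c) → PolyFun 0 c g
  horner   : ∀ {k c g h} (a : ℤ) → PolyFun k c h →
             (∀ n → g n ≡ a + n * h n) → PolyFun (suc k) c g

polyFun-ext : ∀ {k c g g′} → (∀ n → g n ≡ g′ n) → PolyFun k c g → PolyFun k c g′
polyFun-ext g≗g′ (constant eq) = constant λ n → trans (sym (g≗g′ n)) (eq n)
polyFun-ext g≗g′ (horner a p eq) = horner a p λ n → trans (sym (g≗g′ n)) (eq n)

evalℤ-polyFun : ∀ cs c → PolyFun (length cs) c (evalℤ (cs ++ [ c ]))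
evalℤ-polyFun []       c = constant λ n → last c n
  where
  last : ∀ c n → c + n * + 0 ≡ c
  last = solve-∀
evalℤ-polyFun (a ∷ cs) c = horner a (evalℤ-polyFun cs c) λ _ → refl

polyFun-+ : ∀ {k c₁ c₂ g₁ g₂} → PolyFun k c₁ g₁ → PolyFun k c₂ g₂ →
            PolyFun k (c₁ + c₂) (λ n → g₁ n + g₂ n)
polyFun-+ (constant eq₁) (constant eq₂) = constant λ n → cong₂ _+_ (eq₁ n) (eq₂ n)
polyFun-+ (horner {h = h₁} a₁ p₁ eq₁) (horner {h = h₂} a₂ p₂ eq₂) =
  horner (a₁ + a₂) (polyFun-+ p₁ p₂) λ n →
    trans (cong₂ _+_ (eq₁ n) (eq₂ n)) (regroup a₁ a₂ n (h₁ n) (h₂ n))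
  where
  regroup : ∀ a₁ a₂ n x y → (a₁ + n * x) + (a₂ + n * y) ≡ (a₁ + a₂) + n * (x + y)
  regroup = solve-∀

polyFun-raise : ∀ {k c g} → PolyFun k c g → PolyFun (suc k) 0ℤ g
polyFun-raise {c = c} (constant eq) =
  horner c (constant λ _ → refl) λ n → trans (eq n) (pad c n)
  where
  pad : ∀ c n → c ≡ c + n * 0ℤ
  pad = solve-∀
polyFun-raise (horner a p eq) = horner a (polyFun-raise p) eq

-- Shifting the argument preserves degree and top coefficient:
-- a + (n+1) h(n+1) = (a + n h(n+1)) + h(n+1), the second summand of lower degree.
polyFun-shift : ∀ {k c g} → PolyFun k c g → PolyFun k c (g ∘ (_+ 1ℤ))
polyFun-shift (constant eq) = constant (eq ∘ (_+ 1ℤ))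
polyFun-shift {c = c} (horner {h = h} a p eq) =
  subst (λ c′ → PolyFun _ c′ _) (ℤP.+-identityʳ c)
    (polyFun-ext split
      (polyFun-+ (horner a (polyFun-shift p) λ _ → refl)
                 (polyFun-raise (polyFun-shift p))))
  where
  expand : ∀ a n y → (a + n * y) + y ≡ a + (n + 1ℤ) * y
  expand = solve-∀
  split : ∀ n → (a + n * h (n + 1ℤ)) + h (n + 1ℤ) ≡ _
  split n = trans (expand a n (h (n + 1ℤ))) (sym (eq (n + 1ℤ)))

Δ : (ℤ → ℤ) → ℤ → ℤ
Δ g n = g (n + 1ℤ) - g n

-- Δ lowers the degree by one and multiplies the top coefficient by the degree.
-- For g(n) = a + n h(n):  Δg(n) = h(n+1) + n Δh(n).
polyFun-Δ : ∀ {k c g} → PolyFun (suc k) c g → PolyFun k (+ suc k * c) (Δ g)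
polyFun-Δ {zero} {c} {g} (horner {h = h} a (constant eq) eqg) = constant λ n → begin
  Δ g n
    ≡⟨ cong₂ _-_ (eqg (n + 1ℤ)) (eqg n) ⟩
  (a + (n + 1ℤ) * h (n + 1ℤ)) - (a + n * h n)
    ≡⟨ cong₂ (λ u v → (a + (n + 1ℤ) * u) - (a + n * v)) (eq (n + 1ℤ)) (eq n) ⟩
  (a + (n + 1ℤ) * c) - (a + n * c)
    ≡⟨ slope a n c ⟩
  + 1 * c
    ∎
  where
  open ≡-Reasoning
  slope : ∀ a n c → (a + (n + 1ℤ) * c) - (a + n * c) ≡ + 1 * c
  slope = solve-∀
polyFun-Δ {suc k} {c} {g} (horner {h = h} a p eqg) =
  subst (λ c′ → PolyFun _ c′ _) (top c (+ k))
    (polyFun-ext difference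
      (polyFun-+ (polyFun-shift p) (horner 0ℤ (polyFun-Δ p) λ _ → sym (ℤP.+-identityˡ _))))
  where
  top : ∀ c k → c + (+ 1 + k) * c ≡ (+ 1 + (+ 1 + k)) * c
  top = solve-∀
  expand : ∀ a n x y → x + n * (x - y) ≡ (a + (n + 1ℤ) * x) - (a + n * y)
  expand = solve-∀
  difference : ∀ n → h (n + 1ℤ) + n * Δ h n ≡ Δ g n
  difference n = trans (expand a n (h (n + 1ℤ)) (h n)) (sym (cong₂ _-_ (eqg (n + 1ℤ)) (eqg n)))

∣-Δ : ∀ {d g} → (∀ n → d ℤ∣.∣ g n) → ∀ n → d ℤ∣.∣ Δ g n
∣-Δ d∣g n = ℤ∣.∣m∣n⇒∣m-n (d∣g (n + 1ℤ)) (d∣g n)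

∣-top·factorial : ∀ {k c g d} → PolyFun k c g → (∀ n → d ℤ∣.∣ g n) → d ℤ∣.∣ c * + (k !)
∣-top·factorial {c = c} (constant eq) d∣g =
  subst (_ ℤ∣.∣_) (trans (eq 0ℤ) (sym (ℤP.*-identityʳ c))) (d∣g 0ℤ)
∣-top·factorial {suc k} {c} p d∣g =
  subst (_ ℤ∣.∣_) reorder (∣-top·factorial (polyFun-Δ p) (∣-Δ d∣g))
  where
  open ≡-Reasoning
  rearrange : ∀ m c f → m * c * f ≡ c * (m * f)
  rearrange = solve-∀
  reorder : + suc k * c * + (k !) ≡ c * + (suc k !)
  reorder = begin
    + suc k * c * + (k !)    ≡⟨ rearrange (+ suc k) c (+ (k !)) ⟩
    c * (+ suc k * + (k !))  ≡⟨ cong (c *_) (sym (ℤP.pos-* (suc k) (k !))) ⟩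
    c * + (suc k !)          ∎

∣-factorial-deg : ∀ f → Monic f → (d : ℕ) → (∀ n → d ∣ ∣ evalℤ f n ∣) → d ∣ deg f !
∣-factorial-deg .(cs ++ [ + 1 ]) (cs , refl) d d∣f =
  subst (λ m → d ∣ m !) (sym deg≡) (subst (d ∣_) (cong ∣_∣ (ℤP.*-identityˡ (+ (length cs !))))
    (ℤ∣.∣⇒∣ᵤ (∣-top·factorial {d = + d} (evalℤ-polyFun cs (+ 1)) (ℤ∣.∣ᵤ⇒∣ ∘ d∣f))))
  where
  deg≡ : deg (cs ++ [ + 1 ]) ≡ length cs
  deg≡ = trans (cong (ℕ._∸ 1) (ListP.length-++ cs)) (ℕP.m+n∸n≡m (length cs) 1)

proposition4p1 : (s : ℕ) → 2 ≤ s → (f : Fin s → ℤPoly) →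
    (∀ j → Monic (f j)) → Coprime f →
    (d : ℕ) →
    (∀ j (n : ℤ) → d ∣ ∣ evalℤ (f j) n ∣) →
    (∀ (e : ℕ) → (∀ j (n : ℤ) → e ∣ ∣ evalℤ (f j) n ∣) → e ∣ d) →
    ∀ j → d ∣ (deg (f j)) !
proposition4p1 _ _ f monic _ d d∣f _ j = ∣-factorial-deg (f j) (monic j) d (d∣f j)
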